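{- Let $G$ be a finite simple graph with at least two vertices which is a König–Egerváry graph, i.e. $\alpha(G)+\mu(G)=|V(G)|$. Then $G$ is $\alpha^{++}$-stable if and only if $G$ has a perfect matching consisting only of pendant edges and $G$ contains no cycle on $4$ vertices (that is, no four vertices of $G$ span a subgraph containing a cycle of length $4$).
   Context: All graphs are finite, simple, with at least two vertices. $\alpha(G)$ is the stability number (maximum size of a stable set) and $\mu(G)$ the maximum size of a matching. A pendant edge is an edge $vw$ such that $v$ has exactly one neighbour. For $e\in E(\overline{G})$ (a pair of distinct non-adjacent vertices of $G$), $G+e$ is the graph obtained by adding the edge $e$. $G$ is $\alpha^{++}$-stable if $\alpha(G+e_1+e_2)=\alpha(G)$ for any $e_1,e_2\in E(\overline{G})$ (not necessarily distinct). -}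

module Defs where

open import Data.Nat using (ℕ; _+_; _*_; _≤_)
open import Data.Fin using (Fin; _≟_)
open import Data.Fin.Subset using (Subset; _∈_; ∣_∣)
open import Data.Bool using (Bool; true; false; _∨_; _∧_)
open import Data.List using (List; length; concatMap; _∷_; [])
open import Data.List.Membership.Propositional as L using ()
open import Data.List.Relation.Unary.All using (All)
open import Data.List.Relation.Unary.Unique.Propositional using (Unique)
open import Data.Product using (Σ; ∃; _×_; _,_)
open import Relation.Binary.PropositionalEquality using (_≡_; _≢_)
open import Relation.Nullary.Decidable using (⌊_⌋)

Adj : ℕ → Set
Adj n = Fin n → Fin n → Bool

IsSimpleGraph : ∀ {n} → Adj n → Set
IsSimpleGraph {n} G = (∀ (i j : Fin n) → G i j ≡ G j i) × (∀ (i : Fin n) → G i i ≡ false)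

NonEdge : ∀ {n} → Adj n → Fin n → Fin n → Set
NonEdge G u v = (u ≢ v) × (G u v ≡ false)

addEdge : ∀ {n} → Adj n → Fin n → Fin n → Adj n
addEdge G u v x y = G x y ∨ (⌊ x ≟ u ⌋ ∧ ⌊ y ≟ v ⌋) ∨ (⌊ x ≟ v ⌋ ∧ ⌊ y ≟ u ⌋)

IsStable : ∀ {n} → Adj n → Subset n → Set
IsStable G S = ∀ i j → i ∈ S → j ∈ S → G i j ≡ false

IsAlpha : ∀ {n} → Adj n → ℕ → Set
IsAlpha G k = (Σ _ λ S → IsStable G S × ∣ S ∣ ≡ k) × (∀ S → IsStable G S → ∣ S ∣ ≤ k)

endpoints : ∀ {n} → List (Fin n × Fin n) → List (Fin n)
endpoints = concatMap (λ { (u , v) → u ∷ v ∷ [] })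

IsMatching : ∀ {n} → Adj n → List (Fin n × Fin n) → Set
IsMatching G M = All (λ { (u , v) → G u v ≡ true }) M × Unique (endpoints M)

IsMu : ∀ {n} → Adj n → ℕ → Set
IsMu G k = (Σ _ λ M → IsMatching G M × length M ≡ k) × (∀ M → IsMatching G M → length M ≤ k)

IsKE : ∀ {n} → Adj n → Set
IsKE {n} G = Σ ℕ λ a → Σ ℕ λ m → IsAlpha G a × IsMu G m × a + m ≡ n

-- α⁺⁺-stable: α(G + e₁ + e₂) = α(G) for all (not necessarily distinct) e₁, e₂ ∈ E(Ḡ).
IsAlpha++Stable : ∀ {n} → Adj n → Set
IsAlpha++Stable {n} G =
  ∀ (u₁ v₁ u₂ v₂ : Fin n) → NonEdge G u₁ v₁ → NonEdge G u₂ v₂ →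
  ∀ k → IsAlpha G k → IsAlpha (addEdge (addEdge G u₁ v₁) u₂ v₂) k

HasDegreeOne : ∀ {n} → Adj n → Fin n → Set
HasDegreeOne {n} G v = Σ (Fin n) λ w → G v w ≡ true × (∀ x → G v x ≡ true → x ≡ w)

IsPendantEdge : ∀ {n} → Adj n → Fin n × Fin n → Set
IsPendantEdge G (u , v) = G u v ≡ true × (HasDegreeOne G u Data.Sum.⊎ HasDegreeOne G v)
  where import Data.Sum

HasPendantPerfectMatching : ∀ {n} → Adj n → Set
HasPendantPerfectMatching {n} G =
  Σ _ λ M → IsMatching G M × (∀ (x : Fin n) → x L.∈ endpoints M) × All (IsPendantEdge G) M

HasC4 : ∀ {n} → Adj n → Set
HasC4 {n} G = Σ (Fin n) λ a → Σ (Fin n) λ b → Σ (Fin n) λ c → Σ (Fin n) λ d →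
  (a ≢ b) × (a ≢ c) × (a ≢ d) × (b ≢ c) × (b ≢ d) × (c ≢ d) ×
  G a b ≡ true × G b c ≡ true × G c d ≡ true × G d a ≡ true

{-# OPTIONS --safe #-}
module Submission where

-- Counting vertices gives |S| + |M| ≤ n for every stable set S and matching M, with equality only
-- if S contains every vertex missed by M and one end of every edge of M.  In a König–Egerváry graph
-- a maximum matching M attains this bound with every maximum stable set.  α⁺⁺-stability implies
-- that for any two pairs of distinct vertices some maximum stable set contains neither pair, so it
-- is refuted by two pairs one of which lies inside every maximum stable set.  If M misses x, pair
-- x with another vertex y and with the partner of y, if any.  If neither end of an edge xy of M
-- has degree one, take x and y, each with the partner of a further neighbour.  If a b c d is a C4,
-- take the partners of a and c, and those of b and d.
-- Conversely, let M be a perfect matching by pendant edges and call a degree-one end of each edge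
-- its leaf.  For every independent set F of non-leaves, F together with the leaves whose partner is
-- outside F is a stable set of size |M| = α.  Some F with at most two vertices keeps both ends of
-- each added edge out of this set: when all four ends are leaves, F takes a partner from each edge,
-- and C4-freeness makes two such partners non-adjacent.

open import Data.Bool as Bool using (Bool; true; false; not)
open import Data.Bool.Properties using (not-¬; ¬-not; ∨-zeroʳ)
open import Data.Empty using (⊥-elim)
open import Data.Fin as Fin using (Fin; zero; suc; punchIn)
open import Data.Fin.Properties using (_≟_; any?; all?; ¬∀⟶∃¬; punchInᵢ≢i; _<?_; <-asym; <-cmp)
open import Data.Fin.Subset using (Subset; _∈_; _∉_; ∣_∣; inside; outside)
open import Data.Fin.Subset.Properties using (_∈?_)
open import Data.List using (List; []; _∷_; length; map)
open import Data.List.Membership.Propositional using () renaming (_∈_ to _∈ₗ_; _∉_ to _∉ₗ_)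
open import Data.List.Relation.Unary.All as All using (All; []; _∷_)
open import Data.List.Relation.Unary.All.Properties using (All¬⇒¬Any)
open import Data.List.Relation.Unary.AllPairs using ([]; _∷_)
open import Data.List.Relation.Unary.Any as Any using (here; there)
open import Data.List.Relation.Unary.Unique.Propositional using (Unique)
open import Data.Nat using (ℕ; zero; suc; _+_; _*_; _≤_; _<_; z≤n; s≤s)
open import Data.Nat.ListAction using (sum)
open import Data.Nat.Properties
  using ( +-0-commutativeMonoid; module ≤-Reasoning; ≤-refl; ≤-reflexive; ≤-trans; ≤-antisym; <⇒≢
        ; m≤m+n; m≤n+m; +-assoc; +-suc; +-identityʳ; +-mono-≤; +-monoˡ-≤; +-monoʳ-≤; +-mono-<-≤
        ; +-mono-≤-<; +-cancelʳ-≤; *-identityˡ; *-identityʳ; *-zeroʳ; *-distribˡ-+ )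
open import Data.Product as Product using (_×_; _,_; ∃-syntax; proj₁; proj₂)
open import Data.Sum as Sum using (_⊎_; inj₁; inj₂)
open import Data.Vec using ([]; _∷_; tabulate)
open import Data.Vec.Properties using (lookup∘tabulate; []=⇒lookup; lookup⇒[]=)
open import Function using (_∘_; id; flip)
open import Function.Bundles using (_⇔_; mk⇔; Equivalence)
open import Function.Construct.Composition using (_⇔-∘_)
open import Relation.Binary.Definitions using (tri<; tri≈; tri>)
open import Relation.Binary.PropositionalEquality
  using (_≡_; _≢_; refl; sym; trans; cong; cong₂; subst; module ≡-Reasoning)
open import Relation.Nullary using (Dec; does; yes; no; ¬_; contradiction)
open import Relation.Nullary.Decidable using (dec-true; dec-false; decidable-stable; _×-dec_; _→-dec_)

open import Defs

open import Algebra.Properties.CommutativeMonoid.Sum +-0-commutativeMonoid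
  using (sum-syntax; sum-cong-≗; ∑-distrib-+; sum-replicate-zero)

private
  variable
    n k : ℕ
    A : Set
    x y z u v : Fin n
    M : List (Fin n × Fin n)
    p : Subset n
    H H′ : Adj n

-- Counting vertices

χ : Bool → ℕ
χ true  = 1
χ false = 0

indicator : Dec A → ℕ
indicator a? = χ (does a?)

indicator-yes : (a? : Dec A) → A → indicator a? ≡ 1
indicator-yes a? a = cong χ (dec-true a? a)

indicator-no : (a? : Dec A) → ¬ A → indicator a? ≡ 0
indicator-no a? ¬a = cong χ (dec-false a? ¬a)

does≡true⇔ : (a? : Dec A) → does a? ≡ true ⇔ A
does≡true⇔ (yes a) = mk⇔ (λ _ → a) (λ _ → refl)
does≡true⇔ (no ¬a) = mk⇔ (λ ()) (flip contradiction ¬a)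

not-does≡true⇔ : (a? : Dec A) → not (does a?) ≡ true ⇔ (¬ A)
not-does≡true⇔ (yes a) = mk⇔ (λ ()) (contradiction a)
not-does≡true⇔ (no ¬a) = mk⇔ (λ _ → ¬a) (λ _ → refl)

∈tabulate⇔ : ∀ (f : Fin n → Bool) x → x ∈ tabulate f ⇔ f x ≡ true
∈tabulate⇔ f x = mk⇔
  (λ x∈ → trans (sym (lookup∘tabulate f x)) ([]=⇒lookup x∈))
  (λ fx → lookup⇒[]= x (tabulate f) (trans (lookup∘tabulate f x) fx))

∑-mono-≤ : {f g : Fin n → ℕ} → (∀ x → f x ≤ g x) → ∑[ x < n ] f x ≤ ∑[ x < n ] g x
∑-mono-≤ {zero}  f≤g = z≤n
∑-mono-≤ {suc n} f≤g = +-mono-≤ (f≤g zero) (∑-mono-≤ (f≤g ∘ suc))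

∑-mono-< : {f g : Fin n → ℕ} → (∀ x → f x ≤ g x) → ∀ y → f y < g y →
           ∑[ x < n ] f x < ∑[ x < n ] g x
∑-mono-< f≤g zero    fy<gy = +-mono-<-≤ fy<gy (∑-mono-≤ (f≤g ∘ suc))
∑-mono-< f≤g (suc y) fy<gy = +-mono-≤-< (f≤g zero) (∑-mono-< (f≤g ∘ suc) y fy<gy)

∑-const-1 : ∀ n → ∑[ x < n ] 1 ≡ n
∑-const-1 zero    = refl
∑-const-1 (suc n) = cong suc (∑-const-1 n)

∣p∣≡∑indicator : (p : Subset n) → ∣ p ∣ ≡ ∑[ x < n ] indicator (x ∈? p)
∣p∣≡∑indicator []            = refl
∣p∣≡∑indicator (inside  ∷ p) = cong suc (∣p∣≡∑indicator p)
∣p∣≡∑indicator (outside ∷ p) = ∣p∣≡∑indicator p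

∑-*-indicator-≟ : ∀ (f : Fin n → ℕ) y → ∑[ x < n ] (f x * indicator (x ≟ y)) ≡ f y
∑-*-indicator-≟ {suc n} f zero = begin
  f zero * 1 + ∑[ x < n ] (f (suc x) * 0)
    ≡⟨ cong₂ _+_ (*-identityʳ (f zero)) (sum-cong-≗ (*-zeroʳ ∘ f ∘ suc)) ⟩
  f zero + ∑[ x < n ] 0
    ≡⟨ cong (f zero +_) (sum-replicate-zero n) ⟩
  f zero + 0
    ≡⟨ +-identityʳ (f zero) ⟩
  f zero
    ∎
  where open ≡-Reasoning
∑-*-indicator-≟ {suc n} f (suc y) =
  trans (cong (_+ ∑[ x < n ] (f (suc x) * indicator (x ≟ y))) (*-zeroʳ (f zero)))
        (∑-*-indicator-≟ (f ∘ suc) y)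

countInside : Subset n → List (Fin n) → ℕ
countInside p xs = sum (map (λ x → indicator (x ∈? p)) xs)

multiplicity : Fin n → List (Fin n) → ℕ
multiplicity x xs = sum (map (λ y → indicator (x ≟ y)) xs)

sum-map-const-1 : ∀ (xs : List A) → sum (map (λ _ → 1) xs) ≡ length xs
sum-map-const-1 []       = refl
sum-map-const-1 (_ ∷ xs) = cong suc (sum-map-const-1 xs)

∑-*-multiplicity : ∀ (f : Fin n → ℕ) xs → ∑[ x < n ] (f x * multiplicity x xs) ≡ sum (map f xs)
∑-*-multiplicity {n} f []       = trans (sum-cong-≗ (*-zeroʳ ∘ f)) (sum-replicate-zero n)
∑-*-multiplicity {n} f (y ∷ xs) = begin
  ∑[ x < n ] (f x * (indicator (x ≟ y) + multiplicity x xs))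
    ≡⟨ sum-cong-≗ (λ x → *-distribˡ-+ (f x) (indicator (x ≟ y)) (multiplicity x xs)) ⟩
  ∑[ x < n ] (f x * indicator (x ≟ y) + f x * multiplicity x xs)
    ≡⟨ ∑-distrib-+ (λ x → f x * indicator (x ≟ y)) (λ x → f x * multiplicity x xs) ⟩
  ∑[ x < n ] (f x * indicator (x ≟ y)) + ∑[ x < n ] (f x * multiplicity x xs)
    ≡⟨ cong₂ _+_ (∑-*-indicator-≟ f y) (∑-*-multiplicity f xs) ⟩
  f y + sum (map f xs)
    ∎
  where open ≡-Reasoning

∑-multiplicity : ∀ (xs : List (Fin n)) → ∑[ x < n ] multiplicity x xs ≡ length xs
∑-multiplicity {n} xs = begin
  ∑[ x < n ] multiplicity x xs       ≡⟨ sum-cong-≗ (λ x → sym (*-identityˡ (multiplicity x xs))) ⟩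
  ∑[ x < n ] (1 * multiplicity x xs) ≡⟨ ∑-*-multiplicity (λ _ → 1) xs ⟩
  sum (map (λ _ → 1) xs)             ≡⟨ sum-map-const-1 xs ⟩
  length xs                          ∎
  where open ≡-Reasoning

multiplicity-∉ : ∀ {xs} → x ∉ₗ xs → multiplicity x xs ≡ 0
multiplicity-∉ {xs = []}     x∉xs = refl
multiplicity-∉ {xs = y ∷ xs} x∉xs =
  cong₂ _+_ (indicator-no (_ ≟ y) (x∉xs ∘ here)) (multiplicity-∉ (x∉xs ∘ there))

multiplicity-∈ : ∀ {xs} → x ∈ₗ xs → 1 ≤ multiplicity x xs
multiplicity-∈ {x = x} {y ∷ xs} (here x≡y) =
  ≤-trans (≤-reflexive (sym (indicator-yes (x ≟ y) x≡y))) (m≤m+n _ _)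
multiplicity-∈ {x = x} {y ∷ xs} (there x∈xs) =
  ≤-trans (multiplicity-∈ x∈xs) (m≤n+m _ (indicator (x ≟ y)))

multiplicity-unique : ∀ {xs} → Unique xs → ∀ (x : Fin n) → multiplicity x xs ≤ 1
multiplicity-unique []                               x = z≤n
multiplicity-unique {xs = y ∷ xs} (y∉xs ∷ uniq) x with x ≟ y
... | yes refl = ≤-reflexive (cong suc (multiplicity-∉ (All¬⇒¬Any y∉xs)))
... | no  _    = multiplicity-unique uniq x

χ+m≤1+χ*m : ∀ b {m} → m ≤ 1 → χ b + m ≤ 1 + χ b * m
χ+m≤1+χ*m true  z≤n       = ≤-refl
χ+m≤1+χ*m true  (s≤s z≤n) = ≤-refl
χ+m≤1+χ*m false z≤n       = z≤n
χ+m≤1+χ*m false (s≤s z≤n) = ≤-refl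

module _ (p : Subset n) (xs : List (Fin n)) where

  private
    inP : Fin n → ℕ
    inP x = indicator (x ∈? p)

    ∑[inP+multiplicity] : ∑[ x < n ] (inP x + multiplicity x xs) ≡ ∣ p ∣ + length xs
    ∑[inP+multiplicity] = begin
      ∑[ x < n ] (inP x + multiplicity x xs)
        ≡⟨ ∑-distrib-+ inP (λ x → multiplicity x xs) ⟩
      ∑[ x < n ] inP x + ∑[ x < n ] multiplicity x xs
        ≡⟨ cong₂ _+_ (sym (∣p∣≡∑indicator p)) (∑-multiplicity xs) ⟩
      ∣ p ∣ + length xs
        ∎
      where open ≡-Reasoning

    ∑[1+inP*multiplicity] : ∑[ x < n ] (1 + inP x * multiplicity x xs) ≡ n + countInside p xs
    ∑[1+inP*multiplicity] = begin
      ∑[ x < n ] (1 + inP x * multiplicity x xs)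
        ≡⟨ ∑-distrib-+ (λ _ → 1) (λ x → inP x * multiplicity x xs) ⟩
      ∑[ x < n ] 1 + ∑[ x < n ] (inP x * multiplicity x xs)
        ≡⟨ cong₂ _+_ (∑-const-1 n) (∑-*-multiplicity inP xs) ⟩
      n + countInside p xs
        ∎
      where open ≡-Reasoning

    pointwise : Unique xs → ∀ x → inP x + multiplicity x xs ≤ 1 + inP x * multiplicity x xs
    pointwise uniq x = χ+m≤1+χ*m (does (x ∈? p)) (multiplicity-unique uniq x)

  ∣p∣+length≤n+countInside : Unique xs → ∣ p ∣ + length xs ≤ n + countInside p xs
  ∣p∣+length≤n+countInside uniq = begin
    ∣ p ∣ + length xs                          ≡⟨ ∑[inP+multiplicity] ⟨
    ∑[ x < n ] (inP x + multiplicity x xs)     ≤⟨ ∑-mono-≤ (pointwise uniq) ⟩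
    ∑[ x < n ] (1 + inP x * multiplicity x xs) ≡⟨ ∑[1+inP*multiplicity] ⟩
    n + countInside p xs                       ∎
    where open ≤-Reasoning

  ∣p∣+length<n+countInside : Unique xs → y ∉ p → y ∉ₗ xs → ∣ p ∣ + length xs < n + countInside p xs
  ∣p∣+length<n+countInside {y} uniq y∉p y∉xs = begin-strict
    ∣ p ∣ + length xs                          ≡⟨ ∑[inP+multiplicity] ⟨
    ∑[ x < n ] (inP x + multiplicity x xs)     <⟨ ∑-mono-< (pointwise uniq) y strict-at-y ⟩
    ∑[ x < n ] (1 + inP x * multiplicity x xs) ≡⟨ ∑[1+inP*multiplicity] ⟩
    n + countInside p xs                       ∎
    where
    open ≤-Reasoning
    strict-at-y : inP y + multiplicity y xs < 1 + inP y * multiplicity y xs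
    strict-at-y rewrite indicator-no (y ∈? p) y∉p | multiplicity-∉ y∉xs = s≤s z≤n

module _ {xs : List (Fin n)} (uniq : Unique xs) (covers : ∀ x → x ∈ₗ xs) where

  covering⇒∑≡sum : ∀ (f : Fin n → ℕ) → ∑[ x < n ] f x ≡ sum (map f xs)
  covering⇒∑≡sum f = trans (sum-cong-≗ f≡f*multiplicity) (∑-*-multiplicity f xs)
    where
    f≡f*multiplicity : ∀ x → f x ≡ f x * multiplicity x xs
    f≡f*multiplicity x = begin
      f x                     ≡⟨ *-identityʳ (f x) ⟨
      f x * 1                 ≡⟨ cong (f x *_) multiplicity≡1 ⟨
      f x * multiplicity x xs ∎
      where
      open ≡-Reasoning
      multiplicity≡1 : multiplicity x xs ≡ 1
      multiplicity≡1 = ≤-antisym (multiplicity-unique uniq x) (multiplicity-∈ (covers x))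

  covering⇒n≡length : n ≡ length xs
  covering⇒n≡length =
    trans (sym (∑-const-1 n)) (trans (covering⇒∑≡sum (λ _ → 1)) (sum-map-const-1 xs))

  covering⇒∣p∣≡countInside : ∀ p → ∣ p ∣ ≡ countInside p xs
  covering⇒∣p∣≡countInside p =
    trans (∣p∣≡∑indicator p) (covering⇒∑≡sum (λ x → indicator (x ∈? p)))

-- Matchings

_∈ₗ?_ : ∀ (x : Fin n) xs → Dec (x ∈ₗ xs)
x ∈ₗ? xs = Any.any? (x ≟_) xs

Matched : List (Fin n × Fin n) → Fin n → Fin n → Set
Matched M x y = (x , y) ∈ₗ M ⊎ (y , x) ∈ₗ M

matched-sym : Matched M x y → Matched M y x
matched-sym = Sum.swap

matched⇒∈endpoints : Matched M x y → x ∈ₗ endpoints M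
matched⇒∈endpoints {M = _ ∷ M} (inj₁ (here refl))   = here refl
matched⇒∈endpoints {M = _ ∷ M} (inj₂ (here refl))   = there (here refl)
matched⇒∈endpoints {M = _ ∷ M} (inj₁ (there xy∈M)) = there (there (matched⇒∈endpoints (inj₁ xy∈M)))
matched⇒∈endpoints {M = _ ∷ M} (inj₂ (there yx∈M)) = there (there (matched⇒∈endpoints (inj₂ yx∈M)))

∈endpoints⇒matched : ∀ M → x ∈ₗ endpoints M → ∃[ y ] Matched M x y
∈endpoints⇒matched ((a , b) ∷ M) (here refl)         = b , inj₁ (here refl)
∈endpoints⇒matched ((a , b) ∷ M) (there (here refl)) = a , inj₂ (here refl)
∈endpoints⇒matched (_ ∷ M) (there (there x∈M)) =
  Product.map₂ (Sum.map there there) (∈endpoints⇒matched M x∈M)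

matched-∷⁻ : ∀ {a b} → Matched ((a , b) ∷ M) x y →
             (x ≡ a × y ≡ b) ⊎ (x ≡ b × y ≡ a) ⊎ Matched M x y
matched-∷⁻ (inj₁ (here refl))   = inj₁ (refl , refl)
matched-∷⁻ (inj₂ (here refl))   = inj₂ (inj₁ (refl , refl))
matched-∷⁻ (inj₁ (there xy∈M)) = inj₂ (inj₂ (inj₁ xy∈M))
matched-∷⁻ (inj₂ (there yx∈M)) = inj₂ (inj₂ (inj₂ yx∈M))

matched-unique : Unique (endpoints M) → Matched M x y → Matched M x z → y ≡ z
matched-unique {M = []} _ (inj₁ ()) _
matched-unique {M = []} _ (inj₂ ()) _
matched-unique {M = (a , b) ∷ M} ((a≢b ∷ a∉E) ∷ b∉E ∷ uniq) xy xz
  with matched-∷⁻ xy | matched-∷⁻ xz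
... | inj₁ (refl , refl)        | inj₁ (_ , refl)        = refl
... | inj₂ (inj₁ (refl , refl)) | inj₂ (inj₁ (_ , refl)) = refl
... | inj₂ (inj₂ xy∈M)          | inj₂ (inj₂ xz∈M)       = matched-unique uniq xy∈M xz∈M
... | inj₁ (refl , _)           | inj₂ (inj₁ (a≡b , _))  = contradiction a≡b a≢b
... | inj₂ (inj₁ (refl , _))    | inj₁ (b≡a , _)         = contradiction (sym b≡a) a≢b
... | inj₁ (refl , _)           | inj₂ (inj₂ xz∈M)       = contradiction (matched⇒∈endpoints xz∈M) (All¬⇒¬Any a∉E)
... | inj₂ (inj₂ xy∈M)          | inj₁ (refl , _)        = contradiction (matched⇒∈endpoints xy∈M) (All¬⇒¬Any a∉E)
... | inj₂ (inj₁ (refl , _))    | inj₂ (inj₂ xz∈M)       = contradiction (matched⇒∈endpoints xz∈M) (All¬⇒¬Any b∉E)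
... | inj₂ (inj₂ xy∈M)          | inj₂ (inj₁ (refl , _)) = contradiction (matched⇒∈endpoints xy∈M) (All¬⇒¬Any b∉E)

length-endpoints : ∀ (M : List (Fin n × Fin n)) → length (endpoints M) ≡ length M + length M
length-endpoints []      = refl
length-endpoints (_ ∷ M) = cong suc (trans (cong suc (length-endpoints M)) (sym (+-suc _ _)))

Avoids : Subset n → Fin n → Fin n → Set
Avoids p x y = ¬ (x ∈ p × y ∈ p)

ExactlyOne : Subset n → Fin n → Fin n → Set
ExactlyOne p x y = (x ∈ p × y ∉ p) ⊎ (x ∉ p × y ∈ p)

exactlyOne-sym : ExactlyOne p x y → ExactlyOne p y x
exactlyOne-sym = Sum.swap ∘ Sum.map Product.swap Product.swap

module _ (p : Subset n) where

  private
    inP : Fin n → ℕ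
    inP x = indicator (x ∈? p)

    avoids⇒inP≤1 : Avoids p x y → inP x + inP y ≤ 1
    avoids⇒inP≤1 {x = x} {y} ¬xy with x ∈? p | y ∈? p
    ... | yes x∈p | yes y∈p = contradiction (x∈p , y∈p) ¬xy
    ... | yes _   | no  _   = ≤-refl
    ... | no  _   | yes _   = ≤-refl
    ... | no  _   | no  _   = z≤n

    exactlyOne⇒inP≡1 : ExactlyOne p x y → inP x + inP y ≡ 1
    exactlyOne⇒inP≡1 {x = x} {y} (inj₁ (x∈p , y∉p)) =
      cong₂ _+_ (indicator-yes (x ∈? p) x∈p) (indicator-no (y ∈? p) y∉p)
    exactlyOne⇒inP≡1 {x = x} {y} (inj₂ (x∉p , y∈p)) =
      cong₂ _+_ (indicator-no (x ∈? p) x∉p) (indicator-yes (y ∈? p) y∈p)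

    countInside-∷ : ∀ u v M →
      countInside p (endpoints ((u , v) ∷ M)) ≡ (inP u + inP v) + countInside p (endpoints M)
    countInside-∷ u v M = sym (+-assoc (inP u) (inP v) _)

  countInside-endpoints≤ : All (λ (u , v) → Avoids p u v) M → countInside p (endpoints M) ≤ length M
  countInside-endpoints≤ []                             = z≤n
  countInside-endpoints≤ {M = (u , v) ∷ M} (uv ∷ avoids) =
    ≤-trans (≤-reflexive (countInside-∷ u v M)) (+-mono-≤ (avoids⇒inP≤1 uv) (countInside-endpoints≤ avoids))

  countInside-endpoints< : All (λ (u , v) → Avoids p u v) M → (u , v) ∈ₗ M → u ∉ p → v ∉ p →
                           countInside p (endpoints M) < length M
  countInside-endpoints< {M = (u , v) ∷ M} (_ ∷ avoids) (here refl) u∉p v∉p = begin-strict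
    countInside p (endpoints ((u , v) ∷ M))        ≡⟨ countInside-∷ u v M ⟩
    (inP u + inP v) + countInside p (endpoints M) ≡⟨ cong (_+ countInside p (endpoints M)) uv-outside ⟩
    countInside p (endpoints M)                    <⟨ s≤s (countInside-endpoints≤ avoids) ⟩
    length ((u , v) ∷ M)                           ∎
    where
    open ≤-Reasoning
    uv-outside : inP u + inP v ≡ 0
    uv-outside = cong₂ _+_ (indicator-no (u ∈? p) u∉p) (indicator-no (v ∈? p) v∉p)
  countInside-endpoints< {M = (u′ , v′) ∷ M} (uv′ ∷ avoids) (there uv∈M) u∉p v∉p = begin-strict
    countInside p (endpoints ((u′ , v′) ∷ M))        ≡⟨ countInside-∷ u′ v′ M ⟩
    (inP u′ + inP v′) + countInside p (endpoints M) ≤⟨ +-monoˡ-≤ _ (avoids⇒inP≤1 uv′) ⟩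
    1 + countInside p (endpoints M)                  <⟨ s≤s (countInside-endpoints< avoids uv∈M u∉p v∉p) ⟩
    length ((u′ , v′) ∷ M)                           ∎
    where open ≤-Reasoning

  countInside-endpoints≡ : All (λ (u , v) → ExactlyOne p u v) M → countInside p (endpoints M) ≡ length M
  countInside-endpoints≡ []                            = refl
  countInside-endpoints≡ {M = (u , v) ∷ M} (uv ∷ exact) =
    trans (countInside-∷ u v M) (cong₂ _+_ (exactlyOne⇒inP≡1 uv) (countInside-endpoints≡ exact))

-- Stable sets and added edges

Subgraph : Adj n → Adj n → Set
Subgraph {n} H H′ = ∀ (i j : Fin n) → H i j ≡ true → H′ i j ≡ true

stable⇒avoids : IsStable H p → H x y ≡ true → Avoids p x y
stable⇒avoids stable xy (x∈p , y∈p) = not-¬ xy (stable _ _ x∈p y∈p)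

stable-subgraph : Subgraph H H′ → IsStable H′ p → IsStable H p
stable-subgraph {H = H} H⊆H′ stable′ i j i∈p j∈p with H i j in ij
... | false = refl
... | true  = contradiction (i∈p , j∈p) (stable⇒avoids stable′ (H⊆H′ i j ij))

isAlpha-supergraph : Subgraph H H′ → IsAlpha H k → IsStable H′ p → ∣ p ∣ ≡ k → IsAlpha H′ k
isAlpha-supergraph H⊆H′ (_ , maximum) stable′ size =
  (_ , stable′ , size) , λ q stable-q → maximum q (stable-subgraph H⊆H′ stable-q)

addEdge-supergraph : ∀ (H : Adj n) u v → Subgraph H (addEdge H u v)
addEdge-supergraph H u v i j ij rewrite ij = refl

addEdge²-supergraph : ∀ (H : Adj n) a b c d → Subgraph H (addEdge (addEdge H a b) c d)
addEdge²-supergraph H a b c d i j = addEdge-supergraph (addEdge H a b) c d i j ∘ addEdge-supergraph H a b i j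

addEdge-adjacent : ∀ (H : Adj n) u v → addEdge H u v u v ≡ true
addEdge-adjacent H u v with u ≟ u | v ≟ v
... | yes _  | yes _  = ∨-zeroʳ (H u v)
... | no u≢u | _      = contradiction refl u≢u
... | yes _  | no v≢v = contradiction refl v≢v

addEdge-stable : IsStable H p → Avoids p u v → IsStable (addEdge H u v) p
addEdge-stable {u = u} {v = v} stable ¬uv i j i∈p j∈p
  rewrite stable i j i∈p j∈p with i ≟ u | j ≟ v | i ≟ v | j ≟ u
... | yes refl | yes refl | _        | _        = contradiction (i∈p , j∈p) ¬uv
... | _        | _        | yes refl | yes refl = contradiction (j∈p , i∈p) ¬uv
... | no _     | _        | no _     | _        = refl
... | no _     | _        | yes _    | no _     = refl
... | yes _    | no _     | no _     | _        = refl
... | yes _    | no _     | yes _    | no _     = refl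

module _ {H : Adj n} {k} (α : IsAlpha H k) (stable++ : IsAlpha++Stable H) where

  private
    avoiding-nonedges : ∀ {a₁ b₁ a₂ b₂} → NonEdge H a₁ b₁ → NonEdge H a₂ b₂ →
                        ∃[ T ] IsStable H T × ∣ T ∣ ≡ k × Avoids T a₁ b₁ × Avoids T a₂ b₂
    avoiding-nonedges {a₁} {b₁} {a₂} {b₂} e₁ e₂ =
      let (T , stable₂ , size) , _ = stable++ a₁ b₁ a₂ b₂ e₁ e₂ k α
          H₁ = addEdge H a₁ b₁
      in  T
        , stable-subgraph (addEdge²-supergraph H a₁ b₁ a₂ b₂) stable₂
        , size
        , stable⇒avoids stable₂ (addEdge-supergraph H₁ a₂ b₂ a₁ b₁ (addEdge-adjacent H a₁ b₁))
        , stable⇒avoids stable₂ (addEdge-adjacent H₁ a₂ b₂)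

  avoiding-maximum-stable : ∀ {a₁ b₁ a₂ b₂} → a₁ ≢ b₁ → a₂ ≢ b₂ →
                            ∃[ T ] IsStable H T × ∣ T ∣ ≡ k × Avoids T a₁ b₁ × Avoids T a₂ b₂
  avoiding-maximum-stable {a₁} {b₁} {a₂} {b₂} a₁≢b₁ a₂≢b₂ with H a₁ b₁ in e₁ | H a₂ b₂ in e₂
  ... | false | false = avoiding-nonedges (a₁≢b₁ , e₁) (a₂≢b₂ , e₂)
  ... | true  | false =
    let T , stable , size , _ , avoids₂ = avoiding-nonedges (a₂≢b₂ , e₂) (a₂≢b₂ , e₂)
    in  T , stable , size , stable⇒avoids stable e₁ , avoids₂
  ... | false | true  =
    let T , stable , size , avoids₁ , _ = avoiding-nonedges (a₁≢b₁ , e₁) (a₁≢b₁ , e₁)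
    in  T , stable , size , avoids₁ , stable⇒avoids stable e₂
  ... | true  | true  =
    let (T , stable , size) , _ = α
    in  T , stable , size , stable⇒avoids stable e₁ , stable⇒avoids stable e₂

-- The König–Egerváry bound

cancel-double : ∀ a m n c → a + (m + m) ≤ n + c → c ≤ m → a + m ≤ n
cancel-double a m n c a+2m≤n+c c≤m = +-cancelʳ-≤ m (a + m) n (begin
  a + m + m   ≡⟨ +-assoc a m m ⟩
  a + (m + m) ≤⟨ a+2m≤n+c ⟩
  n + c       ≤⟨ +-monoʳ-≤ n c≤m ⟩
  n + m       ∎)
  where open ≤-Reasoning

module _ {H : Adj n} {p : Subset n} {M} (stable : IsStable H p) (matching : IsMatching H M) where

  private
    avoids : All (λ (u , v) → Avoids p u v) M
    avoids = All.map (stable⇒avoids stable) (proj₁ matching)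

    ∣p∣+2m≤n+c : ∣ p ∣ + (length M + length M) ≤ n + countInside p (endpoints M)
    ∣p∣+2m≤n+c = subst (λ l → ∣ p ∣ + l ≤ n + countInside p (endpoints M)) (length-endpoints M)
                   (∣p∣+length≤n+countInside p (endpoints M) (proj₂ matching))

    ∣p∣+2m<n+c : x ∉ p → x ∉ₗ endpoints M →
                 ∣ p ∣ + (length M + length M) < n + countInside p (endpoints M)
    ∣p∣+2m<n+c x∉p x∉E = subst (λ l → ∣ p ∣ + l < n + countInside p (endpoints M)) (length-endpoints M)
                           (∣p∣+length<n+countInside p (endpoints M) (proj₂ matching) x∉p x∉E)

  stable+matching≤n : ∣ p ∣ + length M ≤ n
  stable+matching≤n = cancel-double _ _ _ _ ∣p∣+2m≤n+c (countInside-endpoints≤ p avoids)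

  tight⇒unmatched∈ : ∣ p ∣ + length M ≡ n → x ∉ₗ endpoints M → x ∈ p
  tight⇒unmatched∈ {x} tight x∉E = decidable-stable (x ∈? p) λ x∉p →
    <⇒≢ (cancel-double _ _ _ _ (∣p∣+2m<n+c x∉p x∉E) (countInside-endpoints≤ p avoids)) tight

  tight⇒edge-meets : ∣ p ∣ + length M ≡ n → (u , v) ∈ₗ M → u ∈ p ⊎ v ∈ p
  tight⇒edge-meets {u} {v} tight uv∈M with u ∈? p | v ∈? p
  ... | yes u∈p | _       = inj₁ u∈p
  ... | no _    | yes v∈p = inj₂ v∈p
  ... | no u∉p  | no v∉p  = contradiction tight (<⇒≢ (cancel-double _ _ _ _
    (≤-trans (s≤s ∣p∣+2m≤n+c) (≤-reflexive (sym (+-suc n _))))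
    (countInside-endpoints< p avoids uv∈M u∉p v∉p)))

-- Simple graphs

adjacent⇒≢ : IsSimpleGraph H → H x y ≡ true → x ≢ y
adjacent⇒≢ (_ , loopless) xy refl = not-¬ xy (loopless _)

adjacent-sym : IsSimpleGraph H → H x y ≡ true → H y x ≡ true
adjacent-sym {x = x} {y} (symmetric , _) xy = trans (symmetric y x) xy

C4-free⇒cross-nonadjacent : IsSimpleGraph H → ¬ HasC4 H → ∀ {x x′ y y′} → x ≢ x′ → y ≢ y′ →
                            ∃[ c ] ∃[ d ] (c ≡ x ⊎ c ≡ x′) × (d ≡ y ⊎ d ≡ y′) × H c d ≡ false
C4-free⇒cross-nonadjacent {H = H} simple C4-free {x} {x′} {y} {y′} x≢x′ y≢y′
  with H x y in xy | H x y′ in xy′ | H x′ y in x′y | H x′ y′ in x′y′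
... | false | _     | _     | _     = x  , y  , inj₁ refl , inj₁ refl , xy
... | true  | false | _     | _     = x  , y′ , inj₁ refl , inj₂ refl , xy′
... | true  | true  | false | _     = x′ , y  , inj₂ refl , inj₁ refl , x′y
... | true  | true  | true  | false = x′ , y′ , inj₂ refl , inj₂ refl , x′y′
... | true  | true  | true  | true  = contradiction
  ( x , y , x′ , y′
  , adjacent⇒≢ simple xy , x≢x′ , adjacent⇒≢ simple xy′
  , adjacent⇒≢ simple (adjacent-sym simple x′y) , y≢y′ , adjacent⇒≢ simple x′y′
  , xy , adjacent-sym simple x′y , x′y′ , adjacent-sym simple xy′ )
  C4-free

hasDegreeOne? : ∀ (H : Adj n) x → Dec (HasDegreeOne H x)
hasDegreeOne? H x = any? λ w → (H x w Bool.≟ true) ×-dec all? λ z → (H x z Bool.≟ true) →-dec (z ≟ w)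

¬degreeOne⇒other-neighbour : ∀ (H : Adj n) → H x y ≡ true → ¬ HasDegreeOne H x →
                             ∃[ z ] H x z ≡ true × z ≢ y
¬degreeOne⇒other-neighbour {n} {x} {y} H xy ¬degreeOne
  with ¬∀⟶∃¬ n _ (λ z → (H x z Bool.≟ true) →-dec (z ≟ y)) (λ only-y → ¬degreeOne (y , xy , only-y))
... | z , ¬[xz⇒z≡y] with H x z in xz
... | true  = z , xz , λ z≡y → ¬[xz⇒z≡y] (λ _ → z≡y)
... | false = contradiction (λ ()) ¬[xz⇒z≡y]

another-vertex : 2 ≤ n → ∀ (x : Fin n) → ∃[ y ] x ≢ y
another-vertex (s≤s (s≤s _)) x = punchIn x zero , punchInᵢ≢i x zero ∘ sym


module PerfectMatching {H : Adj n} (simple : IsSimpleGraph H) {M} (matching : IsMatching H M)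
                       (covers : ∀ x → x ∈ₗ endpoints M) where

  partner : Fin n → Fin n
  partner x = proj₁ (∈endpoints⇒matched M (covers x))

  matched-partner : ∀ x → Matched M x (partner x)
  matched-partner x = proj₂ (∈endpoints⇒matched M (covers x))

  partner-unique : Matched M x y → y ≡ partner x
  partner-unique xy = matched-unique (proj₂ matching) xy (matched-partner _)

  partner-involutive : ∀ x → partner (partner x) ≡ x
  partner-involutive x = sym (partner-unique (matched-sym (matched-partner x)))

  partner-injective : partner x ≡ partner y → x ≡ y
  partner-injective {x} {y} px≡py = begin
    x                   ≡⟨ partner-involutive x ⟨
    partner (partner x) ≡⟨ cong partner px≡py ⟩
    partner (partner y) ≡⟨ partner-involutive y ⟩
    y                   ∎
    where open ≡-Reasoning

  partner-adjacent : ∀ x → H x (partner x) ≡ true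
  partner-adjacent x with matched-partner x
  ... | inj₁ xp∈M = All.lookup (proj₁ matching) xp∈M
  ... | inj₂ px∈M = adjacent-sym simple (All.lookup (proj₁ matching) px∈M)

  n≡2m : n ≡ length M + length M
  n≡2m = trans (covering⇒n≡length (proj₂ matching) covers) (length-endpoints M)

  exactlyOne⇒∣p∣≡m : (∀ x → ExactlyOne p x (partner x)) → ∣ p ∣ ≡ length M
  exactlyOne⇒∣p∣≡m {p} exactlyOne =
    trans (covering⇒∣p∣≡countInside (proj₂ matching) covers p)
          (countInside-endpoints≡ p (All.tabulate λ {(u , v)} uv∈M →
            subst (ExactlyOne p u) (sym (partner-unique (inj₁ uv∈M))) (exactlyOne u)))

  stable⇒∣p∣≤m : IsStable H p → ∣ p ∣ ≤ length M
  stable⇒∣p∣≤m {p} stable = +-cancelʳ-≤ (length M) ∣ p ∣ (length M)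
    (subst (∣ p ∣ + length M ≤_) n≡2m (stable+matching≤n stable matching))


module Necessity {H : Adj n} (2≤n : 2 ≤ n) (simple : IsSimpleGraph H) {k} (α : IsAlpha H k)
                 {M} (matching : IsMatching H M) (tight : k + length M ≡ n)
                 (stable++ : IsAlpha++Stable H) where

  private
    Forced : Fin n → Fin n → Fin n → Fin n → Set
    Forced a₁ b₁ a₂ b₂ = ∀ {T} → IsStable H T → ∣ T ∣ ≡ k → (a₁ ∈ T × b₁ ∈ T) ⊎ (a₂ ∈ T × b₂ ∈ T)

    ¬forced : ∀ {a₁ b₁ a₂ b₂} → a₁ ≢ b₁ → a₂ ≢ b₂ → ¬ Forced a₁ b₁ a₂ b₂
    ¬forced a₁≢b₁ a₂≢b₂ forced =
      let T , stable , size , avoids₁ , avoids₂ = avoiding-maximum-stable α stable++ a₁≢b₁ a₂≢b₂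
      in  Sum.[ avoids₁ , avoids₂ ] (forced stable size)

    module _ {T} (stable : IsStable H T) (size : ∣ T ∣ ≡ k) where

      T-tight : ∣ T ∣ + length M ≡ n
      T-tight = trans (cong (_+ length M) size) tight

      maximum⇒unmatched∈ : x ∉ₗ endpoints M → x ∈ T
      maximum⇒unmatched∈ = tight⇒unmatched∈ stable matching T-tight

      maximum⇒matched-meets : Matched M x y → x ∈ T ⊎ y ∈ T
      maximum⇒matched-meets (inj₁ xy∈M) = tight⇒edge-meets stable matching T-tight xy∈M
      maximum⇒matched-meets (inj₂ yx∈M) = Sum.swap (tight⇒edge-meets stable matching T-tight yx∈M)

  covers : ∀ x → x ∈ₗ endpoints M
  covers x = decidable-stable (x ∈ₗ? endpoints M) (unmatched-impossible (another-vertex 2≤n x))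
    where
    unmatched-impossible : ∃[ y ] x ≢ y → ¬ x ∉ₗ endpoints M
    unmatched-impossible (y , x≢y) x∉E with y ∈ₗ? endpoints M
    ... | no y∉E = ¬forced x≢y x≢y λ stable size →
      inj₁ (maximum⇒unmatched∈ stable size x∉E , maximum⇒unmatched∈ stable size y∉E)
    ... | yes y∈E with ∈endpoints⇒matched M y∈E
    ... | z , yz = ¬forced x≢y x≢z λ stable size →
      Sum.map (maximum⇒unmatched∈ stable size x∉E ,_) (maximum⇒unmatched∈ stable size x∉E ,_)
              (maximum⇒matched-meets stable size yz)
      where
      x≢z : x ≢ z
      x≢z refl = x∉E (matched⇒∈endpoints (matched-sym yz))

  open PerfectMatching simple matching covers

  private
    module _ {T} (stable : IsStable H T) (size : ∣ T ∣ ≡ k) where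

      ∉⇒partner∈ : x ∉ T → partner x ∈ T
      ∉⇒partner∈ {x} x∉T =
        Sum.[ flip contradiction x∉T , id ] (maximum⇒matched-meets stable size (matched-partner x))

      neighbour's-partner∈ : x ∈ T → H x y ≡ true → partner y ∈ T
      neighbour's-partner∈ x∈T xy = ∉⇒partner∈ λ y∈T → stable⇒avoids stable xy (x∈T , y∈T)

  pendant-at : ∀ x → HasDegreeOne H x ⊎ HasDegreeOne H (partner x)
  pendant-at x with hasDegreeOne? H x | hasDegreeOne? H (partner x)
  ... | yes x-deg₁ | _           = inj₁ x-deg₁
  ... | no _       | yes px-deg₁ = inj₂ px-deg₁
  ... | no ¬x-deg₁ | no ¬px-deg₁
    with ¬degreeOne⇒other-neighbour H (partner-adjacent x) ¬x-deg₁
       | ¬degreeOne⇒other-neighbour H (partner-adjacent (partner x)) ¬px-deg₁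
  ... | x′ , xx′ , x′≢px | y′ , pxy′ , y′≢ppx = ⊥-elim (¬forced x≢px′ px≢py′ forced)
    where
    x≢px′ : x ≢ partner x′
    x≢px′ x≡px′ = x′≢px (trans (sym (partner-involutive x′)) (cong partner (sym x≡px′)))
    px≢py′ : partner x ≢ partner y′
    px≢py′ px≡py′ = y′≢ppx (trans (sym (partner-injective px≡py′)) (sym (partner-involutive x)))
    forced : Forced x (partner x′) (partner x) (partner y′)
    forced stable size = Sum.map
      (λ x∈T → x∈T , neighbour's-partner∈ stable size x∈T xx′)
      (λ px∈T → px∈T , neighbour's-partner∈ stable size px∈T pxy′)
      (maximum⇒matched-meets stable size (matched-partner x))

  pendant-edges : All (IsPendantEdge H) M
  pendant-edges = All.tabulate λ {(u , v)} uv∈M →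
    All.lookup (proj₁ matching) uv∈M ,
    subst (λ w → HasDegreeOne H u ⊎ HasDegreeOne H w) (sym (partner-unique (inj₁ uv∈M))) (pendant-at u)

  C4-free : ¬ HasC4 H
  C4-free (a , b , c , d , _ , a≢c , _ , _ , b≢d , _ , ab , bc , cd , da) =
    ¬forced (a≢c ∘ partner-injective) (b≢d ∘ partner-injective) forced
    where
    forced : Forced (partner a) (partner c) (partner b) (partner d)
    forced {T} stable size with a ∈? T | c ∈? T
    ... | yes a∈T | _       = inj₂ ( neighbour's-partner∈ stable size a∈T ab
                                   , neighbour's-partner∈ stable size a∈T (adjacent-sym simple da) )
    ... | no _    | yes c∈T = inj₂ ( neighbour's-partner∈ stable size c∈T (adjacent-sym simple bc)
                                   , neighbour's-partner∈ stable size c∈T cd )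
    ... | no a∉T  | no c∉T  = inj₁ (∉⇒partner∈ stable size a∉T , ∉⇒partner∈ stable size c∉T)

  pendant-perfect-matching×C4-free : HasPendantPerfectMatching H × ¬ HasC4 H
  pendant-perfect-matching×C4-free = (M , matching , covers , pendant-edges) , C4-free


module Sufficiency {H : Adj n} (simple : IsSimpleGraph H) {M} (matching : IsMatching H M)
                   (covers : ∀ x → x ∈ₗ endpoints M) (pendant-edges : All (IsPendantEdge H) M)
                   (C4-free : ¬ HasC4 H) where

  open PerfectMatching simple matching covers
  open Equivalence using (to; from)

  pendant-at : ∀ x → HasDegreeOne H x ⊎ HasDegreeOne H (partner x)
  pendant-at x with matched-partner x
  ... | inj₁ xp∈M = proj₂ (All.lookup pendant-edges xp∈M)
  ... | inj₂ px∈M = Sum.swap (proj₂ (All.lookup pendant-edges px∈M))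

  -- The leaf of a matching edge is a degree-one end, the smaller one if both ends qualify.
  IsLeaf : Fin n → Set
  IsLeaf x = HasDegreeOne H x × (HasDegreeOne H (partner x) → x Fin.< partner x)

  leaf? : ∀ x → Dec (IsLeaf x)
  leaf? x = hasDegreeOne? H x ×-dec (hasDegreeOne? H (partner x) →-dec (x <? partner x))

  leaf⇒partner-not-leaf : IsLeaf x → ¬ IsLeaf (partner x)
  leaf⇒partner-not-leaf {x} (x-deg₁ , x<px) (px-deg₁ , px<ppx) =
    <-asym (x<px px-deg₁) (subst (partner x Fin.<_) (partner-involutive x)
      (px<ppx (subst (HasDegreeOne H) (sym (partner-involutive x)) x-deg₁)))

  leaf⊎partner-leaf : ∀ x → IsLeaf x ⊎ IsLeaf (partner x)
  leaf⊎partner-leaf x with hasDegreeOne? H x | hasDegreeOne? H (partner x)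
  ... | no ¬x-deg₁ | no ¬px-deg₁ = contradiction (pendant-at x) Sum.[ ¬x-deg₁ , ¬px-deg₁ ]
  ... | yes x-deg₁ | no ¬px-deg₁ = inj₁ (x-deg₁ , flip contradiction ¬px-deg₁)
  ... | no ¬x-deg₁ | yes px-deg₁ = inj₂ (px-deg₁ , λ ppx-deg₁ →
    contradiction (subst (HasDegreeOne H) (partner-involutive x) ppx-deg₁) ¬x-deg₁)
  ... | yes x-deg₁ | yes px-deg₁ with <-cmp x (partner x)
  ... | tri< x<px _ _ = inj₁ (x-deg₁ , λ _ → x<px)
  ... | tri≈ _ x≡px _ = contradiction x≡px (adjacent⇒≢ simple (partner-adjacent x))
  ... | tri> _ _ px<x = inj₂ (px-deg₁ , λ _ → subst (partner x Fin.<_) (sym (partner-involutive x)) px<x)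

  leaf-neighbour : IsLeaf x → H x y ≡ true → y ≡ partner x
  leaf-neighbour {x} ((_ , _ , only-neighbour) , _) xy =
    trans (only-neighbour _ xy) (sym (only-neighbour _ (partner-adjacent x)))

  inTransversal : List (Fin n) → Fin n → Bool
  inTransversal F x with leaf? x
  ... | yes _ = not (does (partner x ∈ₗ? F))
  ... | no  _ = does (x ∈ₗ? F)

  transversal : List (Fin n) → Subset n
  transversal F = tabulate (inTransversal F)

  leaf∈transversal⇔ : ∀ {F} → IsLeaf x → x ∈ transversal F ⇔ partner x ∉ₗ F
  leaf∈transversal⇔ {x} {F} x-leaf with leaf? x | ∈tabulate⇔ (inTransversal F) x
  ... | yes _      | x∈⇔ = not-does≡true⇔ (partner x ∈ₗ? F) ⇔-∘ x∈⇔
  ... | no ¬x-leaf | _   = contradiction x-leaf ¬x-leaf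

  nonleaf∈transversal⇔ : ∀ {F} → ¬ IsLeaf x → x ∈ transversal F ⇔ x ∈ₗ F
  nonleaf∈transversal⇔ {x} {F} ¬x-leaf with leaf? x | ∈tabulate⇔ (inTransversal F) x
  ... | yes x-leaf | _   = contradiction x-leaf ¬x-leaf
  ... | no _       | x∈⇔ = does≡true⇔ (x ∈ₗ? F) ⇔-∘ x∈⇔

  Independent : List (Fin n) → Set
  Independent F = ∀ {x y} → x ∈ₗ F → y ∈ₗ F → H x y ≡ false

  leaf-neighbour∉transversal : ∀ {F} → IsLeaf x → H x y ≡ true → x ∈ transversal F → y ∉ transversal F
  leaf-neighbour∉transversal {x} {y} {F} x-leaf xy x∈S y∈S =
    to (leaf∈transversal⇔ x-leaf) x∈S (subst (_∈ₗ F) y≡px (to (nonleaf∈transversal⇔ ¬y-leaf) y∈S))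
    where
    y≡px : y ≡ partner x
    y≡px = leaf-neighbour x-leaf xy
    ¬y-leaf : ¬ IsLeaf y
    ¬y-leaf = subst (¬_ ∘ IsLeaf) (sym y≡px) (leaf⇒partner-not-leaf x-leaf)

  transversal-stable : ∀ {F} → Independent F → IsStable H (transversal F)
  transversal-stable independent x y x∈S y∈S = ¬-not nonadjacent
    where
    nonadjacent : H x y ≢ true
    nonadjacent xy with leaf? x | leaf? y
    ... | yes x-leaf | _          = leaf-neighbour∉transversal x-leaf xy x∈S y∈S
    ... | no _       | yes y-leaf = leaf-neighbour∉transversal y-leaf (adjacent-sym simple xy) y∈S x∈S
    ... | no ¬x-leaf | no ¬y-leaf = not-¬ xy
      (independent (to (nonleaf∈transversal⇔ ¬x-leaf) x∈S) (to (nonleaf∈transversal⇔ ¬y-leaf) y∈S))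

  leaf-exactlyOne : ∀ {F} → IsLeaf x → ExactlyOne (transversal F) x (partner x)
  leaf-exactlyOne {x} {F} x-leaf with partner x ∈ₗ? F
  ... | yes px∈F = inj₂ ( (λ x∈S → to (leaf∈transversal⇔ x-leaf) x∈S px∈F)
                        , from (nonleaf∈transversal⇔ (leaf⇒partner-not-leaf x-leaf)) px∈F )
  ... | no  px∉F = inj₁ ( from (leaf∈transversal⇔ x-leaf) px∉F
                        , px∉F ∘ to (nonleaf∈transversal⇔ (leaf⇒partner-not-leaf x-leaf)) )

  ∣transversal∣≡m : ∀ F → ∣ transversal F ∣ ≡ length M
  ∣transversal∣≡m F = exactlyOne⇒∣p∣≡m exactlyOne
    where
    exactlyOne : ∀ x → ExactlyOne (transversal F) x (partner x)
    exactlyOne x with leaf⊎partner-leaf x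
    ... | inj₁ x-leaf  = leaf-exactlyOne x-leaf
    ... | inj₂ px-leaf = exactlyOne-sym
      (subst (ExactlyOne (transversal F) (partner x)) (partner-involutive x) (leaf-exactlyOne px-leaf))

  α≡m : IsAlpha H k → k ≡ length M
  α≡m {k} ((p , stable , ∣p∣≡k) , maximum) = ≤-antisym
    (subst (_≤ length M) ∣p∣≡k (stable⇒∣p∣≤m stable))
    (subst (_≤ k) (∣transversal∣≡m []) (maximum (transversal []) (transversal-stable (λ ()))))

  AvoidingTransversal : Fin n → Fin n → Fin n → Fin n → Set
  AvoidingTransversal a₁ b₁ a₂ b₂ =
    ∃[ F ] Independent F × Avoids (transversal F) a₁ b₁ × Avoids (transversal F) a₂ b₂

  private
    independent-[_] : ∀ c → Independent (c ∷ [])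
    independent-[ c ] (here refl) (here refl) = proj₂ simple c

    independent-pair : ∀ {c d} → H c d ≡ false → Independent (c ∷ d ∷ [])
    independent-pair {c}     cd (here refl)         (here refl)         = proj₂ simple c
    independent-pair         cd (here refl)         (there (here refl)) = cd
    independent-pair         cd (there (here refl)) (here refl)         = trans (proj₁ simple _ _) cd
    independent-pair {d = d} cd (there (here refl)) (there (here refl)) = proj₂ simple d

    nonleaf-avoids : ∀ {F a b} → ¬ IsLeaf z → z ∉ₗ F → z ≡ a ⊎ z ≡ b → Avoids (transversal F) a b
    nonleaf-avoids ¬z-leaf z∉F (inj₁ refl) (a∈S , _) = z∉F (to (nonleaf∈transversal⇔ ¬z-leaf) a∈S)
    nonleaf-avoids ¬z-leaf z∉F (inj₂ refl) (_ , b∈S) = z∉F (to (nonleaf∈transversal⇔ ¬z-leaf) b∈S)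

    leaves-avoid : ∀ {F a b c} → IsLeaf a × IsLeaf b → c ≡ partner a ⊎ c ≡ partner b → c ∈ₗ F →
                   Avoids (transversal F) a b
    leaves-avoid (a-leaf , _) (inj₁ refl) c∈F (a∈S , _) = to (leaf∈transversal⇔ a-leaf) a∈S c∈F
    leaves-avoid (_ , b-leaf) (inj₂ refl) c∈F (_ , b∈S) = to (leaf∈transversal⇔ b-leaf) b∈S c∈F

    leaves⊎nonleaf : ∀ a b → (IsLeaf a × IsLeaf b) ⊎ ∃[ z ] ¬ IsLeaf z × (z ≡ a ⊎ z ≡ b)
    leaves⊎nonleaf a b with leaf? a | leaf? b
    ... | yes a-leaf | yes b-leaf = inj₁ (a-leaf , b-leaf)
    ... | no ¬a-leaf | _          = inj₂ (a , ¬a-leaf , inj₁ refl)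
    ... | yes _      | no ¬b-leaf = inj₂ (b , ¬b-leaf , inj₂ refl)

    leaves-and-nonleaf : ∀ {a b a′ b′} → a ≢ b → IsLeaf a × IsLeaf b → ¬ IsLeaf z → z ≡ a′ ⊎ z ≡ b′ →
                         AvoidingTransversal a b a′ b′
    leaves-and-nonleaf {z = z} {a} {b} a≢b leaves ¬z-leaf z∈ with z ≟ partner a
    ... | no z≢pa  = (partner a ∷ []) , independent-[ partner a ]
                   , leaves-avoid leaves (inj₁ refl) (here refl)
                   , nonleaf-avoids ¬z-leaf (λ { (here z≡pa) → z≢pa z≡pa }) z∈
    ... | yes z≡pa = (partner b ∷ []) , independent-[ partner b ]
                   , leaves-avoid leaves (inj₂ refl) (here refl)
                   , nonleaf-avoids ¬z-leaf z∉[pb] z∈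
      where
      z∉[pb] : z ∉ₗ partner b ∷ []
      z∉[pb] (here z≡pb) = a≢b (partner-injective (trans (sym z≡pa) z≡pb))

  avoiding-transversal : ∀ {a₁ b₁ a₂ b₂} → a₁ ≢ b₁ → a₂ ≢ b₂ → AvoidingTransversal a₁ b₁ a₂ b₂
  avoiding-transversal {a₁} {b₁} {a₂} {b₂} a₁≢b₁ a₂≢b₂ with leaves⊎nonleaf a₁ b₁ | leaves⊎nonleaf a₂ b₂
  ... | inj₂ (z₁ , ¬z₁-leaf , z₁∈) | inj₂ (z₂ , ¬z₂-leaf , z₂∈) =
    [] , (λ ()) , nonleaf-avoids ¬z₁-leaf (λ ()) z₁∈ , nonleaf-avoids ¬z₂-leaf (λ ()) z₂∈
  ... | inj₁ leaves₁ | inj₂ (z , ¬z-leaf , z∈) = leaves-and-nonleaf a₁≢b₁ leaves₁ ¬z-leaf z∈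
  ... | inj₂ (z , ¬z-leaf , z∈) | inj₁ leaves₂ =
    let F , independent , avoids₂ , avoids₁ = leaves-and-nonleaf a₂≢b₂ leaves₂ ¬z-leaf z∈
    in  F , independent , avoids₁ , avoids₂
  ... | inj₁ leaves₁ | inj₁ leaves₂ =
    let c , d , c∈ , d∈ , cd = C4-free⇒cross-nonadjacent simple C4-free
                                 (a₁≢b₁ ∘ partner-injective) (a₂≢b₂ ∘ partner-injective)
    in  (c ∷ d ∷ []) , independent-pair cd
      , leaves-avoid leaves₁ c∈ (here refl) , leaves-avoid leaves₂ d∈ (there (here refl))

  α++-stable : IsAlpha++Stable H
  α++-stable u₁ v₁ u₂ v₂ (u₁≢v₁ , _) (u₂≢v₂ , _) k α =
    let F , independent , avoids₁ , avoids₂ = avoiding-transversal u₁≢v₁ u₂≢v₂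
    in  isAlpha-supergraph (addEdge²-supergraph H u₁ v₁ u₂ v₂) α
          (addEdge-stable (addEdge-stable (transversal-stable independent) avoids₁) avoids₂)
          (trans (∣transversal∣≡m F) (sym (α≡m α)))

theorem5 : ∀ (n : ℕ) → 2 ≤ n → (G : Adj n) → IsSimpleGraph G → IsKE G →
    IsAlpha++Stable G ⇔ (HasPendantPerfectMatching G × ¬ HasC4 G)
theorem5 n 2≤n G simple (a , m , α , ((M , matching , ∣M∣≡m) , _) , a+m≡n) = mk⇔
  (Necessity.pendant-perfect-matching×C4-free 2≤n simple α matching (trans (cong (a +_) ∣M∣≡m) a+m≡n))
  (λ ((_ , matching′ , covers , pendant-edges) , C4-free) →
    Sufficiency.α++-stable simple matching′ covers pendant-edges C4-free)
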